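{- Let $\mathcal{R}$ be a triangle-free induced subgraph of the triangular lattice, and let $P_{n+1}$ be a cutting handle of $\mathcal{R}$ with vertices $v_0,\dots,v_n$ in path order, where $v_0$ is the cutting node. If $n\le 3$, then $n=3$ and $v_3$ has a neighbor $v_4\ne v_2$ of degree at most $2$ in $\mathcal{R}$.
   Context: The triangular lattice has vertex set $\mathbb{Z}^2$, the vertex $(x,y)$ being adjacent to $(x-1,y)$ (left), $(x+1,y)$ (right), $(x-1,y+1)$ (top left), $(x,y+1)$ (top right), $(x,y-1)$ (bottom left) and $(x+1,y-1)$ (bottom right). Nodes of $\mathcal{R}$ are its vertices of degree $3$; a left node is one whose neighbors are its left, top right and bottom right neighbors, and a right node is one whose neighbors are its right, top left and bottom left neighbors. A cutting node of $\mathcal{R}$ is a left node $(x,y)$ such that $y\ge y'$ for every node $(x',y')$ of $\mathcal{R}$, and $x'\le x$ for every left node $(x',y)$. A handle of $\mathcal{R}$ is a path whose end vertices are nodes and whose internal vertices have degree $2$ in $\mathcal{R}$. A cutting handle is a handle one of whose end vertices is the cutting node $(x,y)$ and one of whose internal vertices is $(x,y+1)$. -}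

module Defs where

open import Data.Nat using (ℕ; zero; suc; _<_; _≤_)
open import Data.Integer as ℤ using (ℤ; 1ℤ)
open import Data.Product using (_×_; _,_; Σ)
open import Data.Product.Properties using (≡-dec)
open import Data.List using (List; _∷_; []; filter; length)
open import Data.List.Membership.Propositional using (_∈_)
open import Data.List.Membership.DecPropositional (≡-dec ℤ._≟_ ℤ._≟_) using (_∈?_)
open import Relation.Nullary using (¬_)
open import Relation.Binary.PropositionalEquality using (_≡_)

Vertex : Set
Vertex = ℤ × ℤ

left topRight bottomRight right topLeft bottomLeft : Vertex → Vertex
left        (x , y) = (x ℤ.- 1ℤ , y)
right       (x , y) = (x ℤ.+ 1ℤ , y)
topLeft     (x , y) = (x ℤ.- 1ℤ , y ℤ.+ 1ℤ)
topRight    (x , y) = (x , y ℤ.+ 1ℤ)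
bottomLeft  (x , y) = (x , y ℤ.- 1ℤ)
bottomRight (x , y) = (x ℤ.+ 1ℤ , y ℤ.- 1ℤ)

latticeNbrs : Vertex → List Vertex
latticeNbrs u = left u ∷ right u ∷ topLeft u ∷ topRight u ∷ bottomLeft u ∷ bottomRight u ∷ []

Adj : Vertex → Vertex → Set
Adj u v = v ∈ latticeNbrs u

-- An induced subgraph R of the lattice is given by its (finite) vertex set.
Subgraph : Set
Subgraph = List Vertex

deg : Subgraph → Vertex → ℕ
deg R u = length (filter (_∈? R) (latticeNbrs u))

TriangleFree : Subgraph → Set
TriangleFree R = ∀ a b c → a ∈ R → b ∈ R → c ∈ R →
  ¬ (Adj a b × Adj b c × Adj a c)

Node : Subgraph → Vertex → Set
Node R u = u ∈ R × deg R u ≡ 3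

LeftNode : Subgraph → Vertex → Set
LeftNode R u = Node R u × left u ∈ R × topRight u ∈ R × bottomRight u ∈ R

CuttingNode : Subgraph → Vertex → Set
CuttingNode R (x , y) =
  LeftNode R (x , y)
  × (∀ x' y' → Node R (x' , y') → y' ℤ.≤ y)
  × (∀ x' → LeftNode R (x' , y) → x' ℤ.≤ x)

IsPath : Subgraph → ℕ → (ℕ → Vertex) → Set
IsPath R n v =
  (∀ i → i ≤ n → v i ∈ R)
  × (∀ i → i < n → Adj (v i) (v (suc i)))
  × (∀ i j → i ≤ n → j ≤ n → v i ≡ v j → i ≡ j)

IsHandle : Subgraph → ℕ → (ℕ → Vertex) → Set
IsHandle R n v =
  IsPath R n v × Node R (v 0) × Node R (v n)
  × (∀ i → 0 < i → i < n → deg R (v i) ≡ 2)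

IsCuttingHandle : Subgraph → ℕ → (ℕ → Vertex) → Set
IsCuttingHandle R n v =
  IsHandle R n v × CuttingNode R (v 0)
  × Σ ℕ (λ i → 0 < i × i < n × v i ≡ topRight (v 0))

-- A cutting node p = (x , y) is a left node, so right p and topLeft p are absent, and no
-- node lies above row y. Triangle-freeness puts (x , y + 1) at v₁, and from there the only
-- way down to a node that avoids right p is (x + 1 , y + 1) → (x + 2 , y). Counting
-- neighbours of the degree-3 vertex (x + 2 , y) in a triangle-free R forces (x + 3 , y)
-- into R, and (x + 3 , y) cannot have degree 3: it would be a left node in row y to the
-- right of p.
module Submission where

open import Defs
open import Data.Nat using (ℕ; _≤_)
open import Data.Product using (_×_; Σ)
open import Data.List.Membership.Propositional using (_∈_)
open import Relation.Binary.PropositionalEquality using (_≡_; _≢_)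

open import Data.Nat as ℕ using (suc; z≤n; s≤s; _<_; _+_; _∸_)
import Data.Nat.Properties as ℕ
open import Data.Integer as ℤ using (ℤ; 1ℤ; -1ℤ; pred)
import Data.Integer.Properties as ℤ
open import Data.Product using (_,_; proj₁; proj₂)
open import Data.Sum using (_⊎_; inj₁; inj₂)
open import Data.Empty using (⊥-elim)
open import Function using (_∘_)
open import Data.Bool using (true; false)
open import Data.List using ([]; _∷_; filter; length)
open import Data.List.Relation.Unary.All using (All; []; _∷_)
open import Data.List.Relation.Unary.Any using (here; there)
open import Data.List.Relation.Binary.Sublist.Propositional using (_⊆_; []; _∷_; _∷ʳ_)
open import Data.List.Membership.Propositional using (_∉_)
open import Data.Product.Properties using (≡-dec)
open import Data.List.Membership.DecPropositional (≡-dec ℤ._≟_ ℤ._≟_) using (_∈?_)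
open import Relation.Nullary using (¬_; Dec; yes; no; does; contradiction)
open import Relation.Nullary.Decidable using (decidable-stable)
open import Relation.Unary using (Pred; Decidable; ∁)
open import Relation.Binary.PropositionalEquality using (refl; sym; cong; subst; trans)

module _ {a p} {A : Set a} {P : Pred A p} (P? : Decidable P) where

  length≤length-filter : ∀ {ys xs} → ys ⊆ xs → All P ys → length ys ≤ length (filter P? xs)
  length≤length-filter [] [] = z≤n
  length≤length-filter (x ∷ʳ τ) ps with does (P? x)
  ... | true  = ℕ.m≤n⇒m≤1+n (length≤length-filter τ ps)
  ... | false = length≤length-filter τ ps
  length≤length-filter {xs = x ∷ _} (refl ∷ τ) (px ∷ ps) with P? x
  ... | yes _   = s≤s (length≤length-filter τ ps)
  ... | no ¬px = contradiction px ¬px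

  length-filter+length≤length : ∀ {ys xs} → ys ⊆ xs → All (∁ P) ys →
    length (filter P? xs) + length ys ≤ length xs
  length-filter+length≤length [] [] = z≤n
  length-filter+length≤length (x ∷ʳ τ) ps with does (P? x)
  ... | true  = s≤s (length-filter+length≤length τ ps)
  ... | false = ℕ.m≤n⇒m≤1+n (length-filter+length≤length τ ps)
  length-filter+length≤length {_ ∷ ys} {x ∷ xs} (refl ∷ τ) (¬px ∷ ps) with P? x
  ... | yes px = contradiction px ¬px
  ... | no _   rewrite ℕ.+-suc (length (filter P? xs)) (length ys) =
    s≤s (length-filter+length≤length τ ps)

col row : Vertex → ℤ
col = proj₁
row = proj₂

i+1-1≡i : ∀ i → i ℤ.+ 1ℤ ℤ.- 1ℤ ≡ i
i+1-1≡i i = trans (ℤ.+-assoc i 1ℤ -1ℤ) (ℤ.+-identityʳ i)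

i<i+1 : ∀ i → i ℤ.< i ℤ.+ 1ℤ
i<i+1 i = ℤ.suc[i]≤j⇒i<j (ℤ.≤-reflexive (ℤ.+-comm 1ℤ i))

left-right : ∀ u → left (right u) ≡ u
left-right (x , y) = cong (_, y) (i+1-1≡i x)

topLeft-right : ∀ u → topLeft (right u) ≡ topRight u
topLeft-right (x , y) = cong (_, y ℤ.+ 1ℤ) (i+1-1≡i x)

bottomLeft-topRight : ∀ u → bottomLeft (topRight u) ≡ u
bottomLeft-topRight (x , y) = cong (x ,_) (i+1-1≡i y)

bottomRight-topRight : ∀ u → bottomRight (topRight u) ≡ right u
bottomRight-topRight (x , y) = cong (x ℤ.+ 1ℤ ,_) (i+1-1≡i y)

data Neighbour (u : Vertex) : Vertex → Set where
  toLeft       : Neighbour u (left u)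
  toRight      : Neighbour u (right u)
  toTopLeft    : Neighbour u (topLeft u)
  toTopRight   : Neighbour u (topRight u)
  toBottomLeft : Neighbour u (bottomLeft u)
  toBottomRight : Neighbour u (bottomRight u)

neighbour : ∀ {u w} → Adj u w → Neighbour u w
neighbour (here refl)                                 = toLeft
neighbour (there (here refl))                         = toRight
neighbour (there (there (here refl)))                 = toTopLeft
neighbour (there (there (there (here refl))))         = toTopRight
neighbour (there (there (there (there (here refl))))) = toBottomLeft
neighbour (there (there (there (there (there (here refl)))))) = toBottomRight

adjacent : ∀ {u w} → Neighbour u w → Adj u w
adjacent toLeft        = here refl
adjacent toRight       = there (here refl)
adjacent toTopLeft     = there (there (here refl))
adjacent toTopRight    = there (there (there (here refl)))
adjacent toBottomLeft  = there (there (there (there (here refl))))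
adjacent toBottomRight = there (there (there (there (there (here refl)))))

pred-row-≤ : ∀ {u w} → Adj u w → pred (row u) ℤ.≤ row w
pred-row-≤ {u} a with neighbour a
... | toLeft        = ℤ.i≤j⇒pred[i]≤j ℤ.≤-refl
... | toRight       = ℤ.i≤j⇒pred[i]≤j ℤ.≤-refl
... | toTopLeft     = ℤ.i≤j⇒pred[i]≤j (ℤ.<⇒≤ (i<i+1 (row u)))
... | toTopRight    = ℤ.i≤j⇒pred[i]≤j (ℤ.<⇒≤ (i<i+1 (row u)))
... | toBottomLeft  = ℤ.≤-reflexive (ℤ.+-comm -1ℤ (row u))
... | toBottomRight = ℤ.≤-reflexive (ℤ.+-comm -1ℤ (row u))

module _ {R : Subgraph} where

  deg-≥ : ∀ {u ys} → ys ⊆ latticeNbrs u → All (_∈ R) ys → length ys ≤ deg R u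
  deg-≥ = length≤length-filter (_∈? R)

  deg-≤ : ∀ {u ys} → ys ⊆ latticeNbrs u → All (_∉ R) ys → deg R u ≤ 6 ∸ length ys
  deg-≤ τ ps = ℕ.m+n≤o⇒m≤o∸n _ (length-filter+length≤length (_∈? R) τ ps)

  leftNode-right∉ : ∀ {u} → LeftNode R u → right u ∉ R
  leftNode-right∉ ((_ , deg≡3) , l , t , b) r =
    ℕ.<-irrefl (sym deg≡3) (deg-≥ (refl ∷ refl ∷ _ ∷ʳ refl ∷ _ ∷ʳ refl ∷ []) (l ∷ r ∷ t ∷ b ∷ []))

  leftNode-topLeft∉ : ∀ {u} → LeftNode R u → topLeft u ∉ R
  leftNode-topLeft∉ ((_ , deg≡3) , l , t , b) tl =
    ℕ.<-irrefl (sym deg≡3) (deg-≥ (refl ∷ _ ∷ʳ refl ∷ refl ∷ _ ∷ʳ refl ∷ []) (l ∷ tl ∷ t ∷ b ∷ []))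

  not-both : TriangleFree R → ∀ {u a b} → u ∈ R → Adj u a → Adj u b → Adj a b → a ∈ R → b ∉ R
  not-both tf u∈ ua ub ab a∈ b∈ = tf _ _ _ u∈ a∈ b∈ (ua , ab , ub)

  -- The triangles at bottomRight u leave {right, topLeft, bottomLeft} u as the only
  -- way for u to reach degree 3.
  rightward-continuation : TriangleFree R → ∀ {u} → u ∈ R → deg R u ≡ 3 → left u ∉ R → topLeft u ∈ R →
    right u ∈ R × topRight u ∉ R × bottomRight u ∉ R
  rightward-continuation tf {u} u∈ deg≡3 l∉ tl∈ = right∈ , topRight∉ , bottomRight∉
    where
    topRight∉ : topRight u ∉ R
    topRight∉ tr∈ = not-both tf u∈ (adjacent toTopRight) (adjacent toTopLeft) (adjacent toLeft) tr∈ tl∈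

    bottomRight∉ : bottomRight u ∉ R
    bottomRight∉ br∈ = ℕ.<-irrefl refl (subst (_≤ 2) deg≡3
      (deg-≤ (refl ∷ refl ∷ _ ∷ʳ refl ∷ refl ∷ _ ∷ʳ [])
             (l∉ ∷ r∉ ∷ topRight∉ ∷ bl∉ ∷ [])))
      where
      r∉ : right u ∉ R
      r∉ r∈ = not-both tf u∈ (adjacent toRight) (adjacent toBottomRight) (adjacent toBottomLeft) r∈ br∈
      bl∉ : bottomLeft u ∉ R
      bl∉ bl∈ = not-both tf u∈ (adjacent toBottomLeft) (adjacent toBottomRight) (adjacent toRight) bl∈ br∈

    right∈ : right u ∈ R
    right∈ = decidable-stable (right u ∈? R) λ r∉ → ℕ.<-irrefl refl (subst (_≤ 2) deg≡3
      (deg-≤ (refl ∷ refl ∷ _ ∷ʳ refl ∷ _ ∷ʳ refl ∷ [])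
             (l∉ ∷ r∉ ∷ topRight∉ ∷ bottomRight∉ ∷ [])))

  deg≤2⊎leftNode : TriangleFree R → ∀ {u} → u ∈ R → topLeft u ∉ R → bottomLeft u ∉ R →
    deg R u ≤ 2 ⊎ LeftNode R u
  deg≤2⊎leftNode tf {u} u∈ tl∉ bl∉ = by-right (right u ∈? R)
    where
    by-right : Dec (right u ∈ R) → deg R u ≤ 2 ⊎ LeftNode R u
    by-right (yes r∈) = inj₁ (deg-≤ (_ ∷ʳ _ ∷ʳ refl ∷ refl ∷ refl ∷ refl ∷ []) (tl∉ ∷ tr∉ ∷ bl∉ ∷ br∉ ∷ []))
      where
      tr∉ : topRight u ∉ R
      tr∉ = not-both tf u∈ (adjacent toRight) (adjacent toTopRight)
        (subst (Adj (right u)) (topLeft-right u) (adjacent toTopLeft)) r∈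
      br∉ : bottomRight u ∉ R
      br∉ = not-both tf u∈ (adjacent toRight) (adjacent toBottomRight) (adjacent toBottomLeft) r∈
    by-right (no r∉) = by-rest (left u ∈? R) (topRight u ∈? R) (bottomRight u ∈? R)
      where
      by-rest : Dec (left u ∈ R) → Dec (topRight u ∈ R) → Dec (bottomRight u ∈ R) →
        deg R u ≤ 2 ⊎ LeftNode R u
      by-rest (yes l∈) (yes tr∈) (yes br∈) = inj₂ ((u∈ , ℕ.≤-antisym deg≤3 deg≥3) , l∈ , tr∈ , br∈)
        where
        deg≤3 : deg R u ≤ 3
        deg≤3 = deg-≤ (_ ∷ʳ refl ∷ refl ∷ _ ∷ʳ refl ∷ _ ∷ʳ []) (r∉ ∷ tl∉ ∷ bl∉ ∷ [])
        deg≥3 : 3 ≤ deg R u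
        deg≥3 = deg-≥ (refl ∷ _ ∷ʳ _ ∷ʳ refl ∷ _ ∷ʳ refl ∷ []) (l∈ ∷ tr∈ ∷ br∈ ∷ [])
      by-rest (no l∉) _ _ = inj₁ (deg-≤ (refl ∷ refl ∷ refl ∷ _ ∷ʳ refl ∷ _ ∷ʳ []) (l∉ ∷ r∉ ∷ tl∉ ∷ bl∉ ∷ []))
      by-rest _ (no tr∉) _ = inj₁ (deg-≤ (_ ∷ʳ refl ∷ refl ∷ refl ∷ refl ∷ _ ∷ʳ []) (r∉ ∷ tl∉ ∷ tr∉ ∷ bl∉ ∷ []))
      by-rest _ _ (no br∉) = inj₁ (deg-≤ (_ ∷ʳ refl ∷ refl ∷ _ ∷ʳ refl ∷ refl ∷ []) (r∉ ∷ tl∉ ∷ bl∉ ∷ br∉ ∷ []))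

module FromCuttingNode {R : Subgraph} (tf : TriangleFree R) {p : Vertex} (cut : CuttingNode R p) where

  right∉ : right p ∉ R
  right∉ = leftNode-right∉ (proj₁ cut)

  not-node-above : ∀ {w} → row p ℤ.< row w → ¬ Node R w
  not-node-above {w} p<w node = ℤ.<⇒≱ p<w (proj₁ (proj₂ cut) (col w) (row w) node)

  no-leftNode-three-right : ¬ LeftNode R (right (right (right p)))
  no-leftNode-three-right leftNode = ℤ.<⇒≱ p<u (proj₂ (proj₂ cut) _ leftNode)
    where
    p<u : col p ℤ.< col (right (right (right p)))
    p<u = ℤ.<-trans (i<i+1 _) (ℤ.<-trans (i<i+1 _) (i<i+1 _))

  topRight-successor : ∀ {w} → w ∈ R → Adj (topRight p) w → w ≢ p →
    w ≡ right (topRight p) ⊎ row (topRight p) ℤ.< row w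
  topRight-successor w∈ a w≢p with neighbour a
  ... | toLeft        = ⊥-elim (leftNode-topLeft∉ (proj₁ cut) w∈)
  ... | toRight       = inj₁ refl
  ... | toTopLeft     = inj₂ (i<i+1 _)
  ... | toTopRight    = inj₂ (i<i+1 _)
  ... | toBottomLeft  = ⊥-elim (w≢p (bottomLeft-topRight p))
  ... | toBottomRight = ⊥-elim (right∉ (subst (_∈ R) (bottomRight-topRight p) w∈))

  topRight-successor-above : ∀ {w} → w ∈ R → Adj (topRight p) w → w ≢ p → row p ℤ.< row w
  topRight-successor-above w∈ a w≢p with topRight-successor w∈ a w≢p
  ... | inj₁ refl = i<i+1 (row p)
  ... | inj₂ p₁<w = ℤ.<-trans (i<i+1 (row p)) p₁<w

  node-next-to-right-topRight : ∀ {z} → Node R z → Adj (right (topRight p)) z → z ≡ right (right p)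
  node-next-to-right-topRight node a with neighbour a
  ... | toLeft        = ⊥-elim (not-node-above (i<i+1 _) node)
  ... | toRight       = ⊥-elim (not-node-above (i<i+1 _) node)
  ... | toTopLeft     = ⊥-elim (not-node-above (ℤ.<-trans (i<i+1 _) (i<i+1 _)) node)
  ... | toTopRight    = ⊥-elim (not-node-above (ℤ.<-trans (i<i+1 _) (i<i+1 _)) node)
  ... | toBottomLeft  = ⊥-elim (right∉ (subst (_∈ R) (bottomLeft-topRight (right p)) (proj₁ node)))
  ... | toBottomRight = bottomRight-topRight (right p)

  two-steps-to-node : ∀ {w z} → w ∈ R → Adj (topRight p) w → w ≢ p → Node R z → Adj w z →
    w ≡ right (topRight p) × z ≡ right (right p)
  two-steps-to-node {z = z} w∈ a w≢p node wz with topRight-successor w∈ a w≢p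
  ... | inj₁ refl = refl , node-next-to-right-topRight node wz
  ... | inj₂ p₁<w = ⊥-elim (not-node-above p<z node)
    where
    p<z : row p ℤ.< row z
    p<z = ℤ.<-≤-trans (i<i+1 _) (ℤ.≤-trans (ℤ.i<j⇒i≤pred[j] p₁<w) (pred-row-≤ wz))

  fourth-vertex : ∀ {w z} → w ∈ R → Adj (topRight p) w → w ≢ p → Node R z → Adj w z →
    Σ Vertex λ v₄ → v₄ ∈ R × Adj z v₄ × v₄ ≢ w × deg R v₄ ≤ 2
  fourth-vertex w∈ a w≢p node wz with two-steps-to-node w∈ a w≢p node wz
  ... | refl , refl with rightward-continuation tf (proj₁ node) (proj₂ node) l∉ tl∈
    where
    l∉ : left (right (right p)) ∉ R
    l∉ = right∉ ∘ subst (_∈ R) (left-right (right p))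
    tl∈ : topLeft (right (right p)) ∈ R
    tl∈ = subst (_∈ R) (sym (topLeft-right (right p))) w∈
  ...   | r∈ , tr∉ , br∉ = right (right (right p)) , r∈ , adjacent toRight , rows-differ , deg≤2
    where
    rows-differ : right (right (right p)) ≢ right (topRight p)
    rows-differ e = ℤ.<⇒≢ (i<i+1 (row p)) (cong row e)
    deg≤2 : deg R (right (right (right p))) ≤ 2
    deg≤2 with deg≤2⊎leftNode tf r∈ (tr∉ ∘ subst (_∈ R) (topLeft-right (right (right p)))) br∉
    ... | inj₁ d≤2     = d≤2
    ... | inj₂ leftNode = ⊥-elim (no-leftNode-three-right leftNode)

path-no-chord : ∀ {R} → TriangleFree R → ∀ {n v} → IsPath R n v → 2 ≤ n → ¬ Adj (v 0) (v 2)
path-no-chord tf {n} {v} (∈R , adj , _) 2≤n a₀₂ =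
  tf (v 0) (v 1) (v 2) (∈R 0 z≤n) (∈R 1 1≤n) (∈R 2 2≤n) (adj 0 1≤n , adj 1 2≤n , a₀₂)
  where
  1≤n : 1 ≤ n
  1≤n = ℕ.≤-trans (s≤s z≤n) 2≤n

second-vertex : ∀ {R} → TriangleFree R → ∀ {n v} → IsPath R n v → n ≤ 3 →
  ∀ {i} → 0 < i → i < n → v i ≡ topRight (v 0) → v 1 ≡ topRight (v 0)
second-vertex _  _    _   {1} _ _   vᵢ≡ = vᵢ≡
second-vertex tf path _   {2} _ 2<n vᵢ≡ =
  ⊥-elim (path-no-chord tf path (ℕ.<⇒≤ 2<n) (subst (Adj _) (sym vᵢ≡) (adjacent toTopRight)))
second-vertex _  _    n≤3 {suc (suc (suc i))} _ i<n _ =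
  ⊥-elim (ℕ.<⇒≱ (ℕ.≤-<-trans (ℕ.m≤m+n 3 i) i<n) n≤3)

short-cutting-handle : ∀ {R} → TriangleFree R → ∀ n {v} → CuttingNode R (v 0) → IsPath R n v → Node R (v n) →
  v 1 ≡ topRight (v 0) → 1 < n → n ≤ 3 →
  n ≡ 3 × Σ Vertex (λ v₄ → v₄ ∈ R × Adj (v 3) v₄ × v₄ ≢ v 2 × deg R v₄ ≤ 2)
short-cutting-handle tf 1 _ _ _ _ (s≤s ()) _
short-cutting-handle tf 2 {v} cut (∈R , adj , distinct) nodeₙ v₁≡ _ _ =
  ⊥-elim (not-node-above (topRight-successor-above (∈R 2 ℕ.≤-refl) a₁₂ v₂≢v₀) nodeₙ)
  where
  open FromCuttingNode tf cut
  a₁₂ : Adj (topRight (v 0)) (v 2)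
  a₁₂ = subst (λ u → Adj u (v 2)) v₁≡ (adj 1 ℕ.≤-refl)
  v₂≢v₀ : v 2 ≢ v 0
  v₂≢v₀ = ℕ.1+n≢0 ∘ distinct 2 0 ℕ.≤-refl z≤n
short-cutting-handle tf 3 {v} cut (∈R , adj , distinct) nodeₙ v₁≡ _ _ =
  refl , fourth-vertex (∈R 2 (ℕ.n≤1+n 2)) a₁₂ v₂≢v₀ nodeₙ (adj 2 ℕ.≤-refl)
  where
  open FromCuttingNode tf cut
  a₁₂ : Adj (topRight (v 0)) (v 2)
  a₁₂ = subst (λ u → Adj u (v 2)) v₁≡ (adj 1 (ℕ.n≤1+n 2))
  v₂≢v₀ : v 2 ≢ v 0
  v₂≢v₀ = ℕ.1+n≢0 ∘ distinct 2 0 (ℕ.n≤1+n 2) z≤n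
short-cutting-handle tf (suc (suc (suc (suc _)))) _ _ _ _ _ (s≤s (s≤s (s≤s ())))

lemma4p3 : (R : Subgraph) → TriangleFree R → (n : ℕ) → (v : ℕ → Vertex) →
    IsCuttingHandle R n v → n ≤ 3 →
    n ≡ 3 × Σ Vertex (λ v₄ → v₄ ∈ R × Adj (v 3) v₄ × v₄ ≢ v 2 × deg R v₄ ≤ 2)
lemma4p3 R tf n v ((path , _ , nodeₙ , _) , cut , i , 0<i , i<n , vᵢ≡) n≤3 =
  short-cutting-handle tf n cut path nodeₙ (second-vertex tf path n≤3 0<i i<n vᵢ≡) (ℕ.≤-<-trans 0<i i<n) n≤3
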